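{- Fix $\alpha\in(0,1)$ and $\beta\in(0,1/2]$. There is a constant $c_{\alpha,\beta}$ (depending only on $\alpha,\beta$) such that the following holds. Let $J$ be an instance that can be feasibly scheduled on $m$ machines, and let $j\in J$. Then the number of $\alpha$-tight jobs $j'\in J$ with $\ell_{j'}\le\ell_j$ such that $j$ and $j'$ are $\beta$-agreeable is at most $c_{\alpha,\beta}\cdot m$ (i.e., $\mathcal{O}(m)$).
   Context: An instance is a finite set of jobs $J$; each job $j$ has processing time $p_j\in\mathbb{N}$, release date $r_j\in\mathbb{N}$, deadline $d_j\in\mathbb{N}$, and laxity $\ell_j=d_j-r_j-p_j$. Feasible scheduling on $m$ machines: each job processed for $p_j$ time units within $[r_j,d_j)$, each machine processing at most one job at a time, no job on two machines simultaneously, preemption and migration allowed. A job is $\alpha$-tight if $p_j>\alpha(d_j-r_j)$. For $\beta\le 1/2$ the $\beta$-interval of $j$ is $I_\beta(j)=[r_j+\beta\ell_j,\,d_j-\beta\ell_j)$. Two jobs $j,j'$ are agreeable if $r_j<r_{j'}$ implies $d_j\le d_{j'}$ and $r_{j'}<r_j$ implies $d_{j'}\le d_j$; they are $\beta$-agreeable if they are agreeable and $I_\beta(j)\cap I_\beta(j')\neq\emptyset$.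
   Formalization: The fixed parameters α and β range over the rationals in $(0,1)$ and $(0,1/2]$ respectively. -}

module Defs where

open import Data.Nat as ℕ using (ℕ; zero; suc)
open import Data.Fin using (Fin)
open import Data.Fin.Properties using () renaming (_≟_ to _≟ᶠ_)
open import Data.Maybe using (Maybe; just; nothing)
open import Data.Maybe.Properties using (≡-dec)
open import Data.List using (List; filter; length; upTo; map; allFin)
open import Data.Nat.ListAction using (sum)
open import Data.Integer using (+_)
open import Data.Rational as ℚ using (ℚ; _/_)
open import Data.Product using (_×_; ∃)
open import Relation.Binary.PropositionalEquality using (_≡_)

record Job : Set where
  constructor job
  field
    p r d : ℕ
open Job public

⟦_⟧ : ℕ → ℚ
⟦ n ⟧ = (+ n) / 1

-- Laxity ℓ_j = d_j - r_j - p_j (computed in ℚ, so no truncation).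
laxity : Job → ℚ
laxity j = ℚ._-_ (ℚ._-_ ⟦ d j ⟧ ⟦ r j ⟧) ⟦ p j ⟧

-- An instance: n jobs indexed by Fin n (distinct indices = distinct jobs).
Instance : ℕ → Set
Instance n = Fin n → Job

-- A (preemptive, migratory) schedule on m machines in unit time slots:
-- σ t i = just j  means machine i processes job j during [t, t+1).
Schedule : ℕ → ℕ → Set
Schedule m n = ℕ → Fin m → Maybe (Fin n)

machinesOn : ∀ {m n} → Schedule m n → Fin n → ℕ → ℕ
machinesOn {m} σ j t = length (filter (λ i → ≡-dec _≟ᶠ_ (σ t i) (just j)) (allFin m))

processedBefore : ∀ {m n} → Schedule m n → Fin n → ℕ → ℕ
processedBefore σ j T = sum (map (machinesOn σ j) (upTo T))

record FeasibleSchedule {m n : ℕ} (J : Instance n) (σ : Schedule m n) : Set where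
  field
    inWindow : ∀ t i j → σ t i ≡ just j → r (J j) ℕ.≤ t × t ℕ.< d (J j)
    noParallel : ∀ t i i' j → σ t i ≡ just j → σ t i' ≡ just j → i ≡ i'
    complete : ∀ j → processedBefore σ j (d (J j)) ≡ p (J j)

Feasible : ∀ {n} → ℕ → Instance n → Set
Feasible {n} m J = ∃ λ (σ : Schedule m n) → FeasibleSchedule J σ

Tight : ℚ → Job → Set
Tight α j = ℚ._*_ α (ℚ._-_ ⟦ d j ⟧ ⟦ r j ⟧) ℚ.< ⟦ p j ⟧

InBetaInterval : ℚ → Job → ℚ → Set
InBetaInterval β j x =
  ℚ._+_ ⟦ r j ⟧ (ℚ._*_ β (laxity j)) ℚ.≤ x ×
  x ℚ.< ℚ._-_ ⟦ d j ⟧ (ℚ._*_ β (laxity j))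

Agreeable : Job → Job → Set
Agreeable j j' =
  (r j ℕ.< r j' → d j ℕ.≤ d j') × (r j' ℕ.< r j → d j' ℕ.≤ d j)

BetaAgreeable : ℚ → Job → Job → Set
BetaAgreeable β j j' =
  Agreeable j j' × ∃ λ x → InBetaInterval β j x × InBetaInterval β j' x

{-# OPTIONS --safe #-}
-- Let L be the laxity of j and let j′ be a job counted for j. Since the β-intervals of j and j′
-- meet and the jobs are agreeable, d_j′ − r_j′ > βL; α-tightness gives p_j′ > α(d_j′ − r_j′);
-- hence L < N p_j′ for an integer N depending only on α and β. Agreeability also makes j′ live
-- at slot r_j or at slot d_j − 1. A job live at slot c whose laxity is at most L idles in at most L
-- of its slots, so in the window [c − 2L, c + 2L] it is either processed completely or for more
-- than L units; either way it gets more than L/N units there. The m machines supply at most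
-- 2m(4L + 1) units in the two windows around r_j and d_j − 1, so |S|(L + 1)/N ≤ 8m(L + 1).
module Submission where

open import Defs
open import Data.Nat as ℕ using (ℕ)
open import Data.Fin using (Fin)
open import Data.Fin.Subset using (Subset; _∈_; ∣_∣)
open import Data.Rational as ℚ using (ℚ; 0ℚ; 1ℚ; ½)
open import Data.Product using (_×_; ∃; _,_; proj₁; proj₂)

import Data.Nat.Properties as ℕₚ
open import Data.Sum using (_⊎_; inj₁; inj₂)
open import Relation.Nullary using (¬_; Dec; yes; no; contradiction)
open import Relation.Binary.PropositionalEquality

Live : Job → ℕ → Set
Live k t = r k ℕ.≤ t × t ℕ.< d k

-- Equals the laxity only when r k + p k ≤ d k (see laxity≡slack); otherwise ∸ truncates.
slack : Job → ℕ
slack k = d k ℕ.∸ r k ℕ.∸ p k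

record Competes (N : ℕ) (k k′ : Job) : Set where
  field
    live   : Live k′ (r k) ⊎ Live k′ (ℕ.pred (d k))
    slack≤ : slack k′ ℕ.≤ slack k
    slack< : slack k ℕ.< N ℕ.* p k′

agreeable⇒live : ∀ {k k′} → (r k ℕ.< r k′ → d k ℕ.≤ d k′) → r k ℕ.< d k′ → r k′ ℕ.< d k →
                 Live k′ (r k) ⊎ Live k′ (ℕ.pred (d k))
agreeable⇒live {k} {k′} r<r′⇒d≤d′ r<d′ r′<d with r k′ ℕ.≤? r k
... | yes r′≤r = inj₁ (r′≤r , r<d′)
... | no r′≰r = inj₂ (pred-live r′<d (r<r′⇒d≤d′ (ℕₚ.≰⇒> r′≰r)))
  where
  pred-live : ∀ {r′ d d′} → r′ ℕ.< d → d ℕ.≤ d′ → r′ ℕ.≤ ℕ.pred d × ℕ.pred d ℕ.< d′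
  pred-live (ℕ.s≤s r′≤d) d≤d′ = r′≤d , d≤d′

module FromRationals where

  open import Data.Integer as ℤ using (+_; +[1+_]; +≤+)
  import Data.Integer.Properties as ℤ
  open import Data.Nat.Coprimality using (1-coprimeTo) renaming (sym to coprime-sym)
  open import Data.Rational using (mkℚ; _+_; _-_; _*_; -_; _≤_; _<_; *≤*; *<*; positive; nonNegative)
  import Data.Rational.Properties as ℚₚ
  import Data.Rational.Unnormalised as ℚᵘ
  import Data.Rational.Unnormalised.Properties as ℚᵘ
  open import Data.Rational.Solver using (module +-*-Solver)
  open +-*-Solver using (solve; _:+_; _:*_; _:-_; _:=_)

  ⟦⟧≡mkℚ : ∀ n → ⟦ n ⟧ ≡ mkℚ (+ n) 0 (coprime-sym (1-coprimeTo n))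
  ⟦⟧≡mkℚ n = ℚₚ.normalize-coprime (coprime-sym (1-coprimeTo n))

  ⟦⟧-mono-≤ : ∀ {m n} → m ℕ.≤ n → ⟦ m ⟧ ≤ ⟦ n ⟧
  ⟦⟧-mono-≤ {m} {n} m≤n = subst₂ _≤_ (sym (⟦⟧≡mkℚ m)) (sym (⟦⟧≡mkℚ n))
    (*≤* (ℤ.*-monoʳ-≤-nonNeg (+ 1) (+≤+ m≤n)))

  ⟦⟧-mono-< : ∀ {m n} → m ℕ.< n → ⟦ m ⟧ < ⟦ n ⟧
  ⟦⟧-mono-< {m} {n} m<n = subst₂ _<_ (sym (⟦⟧≡mkℚ m)) (sym (⟦⟧≡mkℚ n))
    (*<* (ℤ.*-monoʳ-<-pos (+ 1) (ℤ.+<+ m<n)))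

  ⟦⟧-cancel-≤ : ∀ {m n} → ⟦ m ⟧ ≤ ⟦ n ⟧ → m ℕ.≤ n
  ⟦⟧-cancel-≤ {m} {n} m≤n with subst₂ _≤_ (⟦⟧≡mkℚ m) (⟦⟧≡mkℚ n) m≤n
  ... | *≤* m*1≤n*1 = ℤ.drop‿+≤+ (ℤ.*-cancelʳ-≤-pos (+ m) (+ n) (+ 1) m*1≤n*1)

  ⟦⟧-cancel-< : ∀ {m n} → ⟦ m ⟧ < ⟦ n ⟧ → m ℕ.< n
  ⟦⟧-cancel-< {m} {n} m<n with subst₂ _<_ (⟦⟧≡mkℚ m) (⟦⟧≡mkℚ n) m<n
  ... | *<* m*1<n*1 = ℤ.drop‿+<+ (ℤ.*-cancelʳ-<-nonNeg (+ 1) m*1<n*1)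

  ⟦⟧-homo-+ : ∀ m n → ⟦ m ⟧ + ⟦ n ⟧ ≡ ⟦ m ℕ.+ n ⟧
  ⟦⟧-homo-+ m n = begin
    ⟦ m ⟧ + ⟦ n ⟧                         ≡⟨ cong₂ _+_ (⟦⟧≡mkℚ m) (⟦⟧≡mkℚ n) ⟩
    (+ m ℤ.* + 1 ℤ.+ + n ℤ.* + 1) ℚ./ 1   ≡⟨ cong (ℚ._/ 1) (cong₂ ℤ._+_ (ℤ.*-identityʳ (+ m)) (ℤ.*-identityʳ (+ n))) ⟩
    ⟦ m ℕ.+ n ⟧                           ∎
    where open ≡-Reasoning

  ⟦⟧-homo-* : ∀ m n → ⟦ m ⟧ * ⟦ n ⟧ ≡ ⟦ m ℕ.* n ⟧
  ⟦⟧-homo-* m n = begin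
    ⟦ m ⟧ * ⟦ n ⟧          ≡⟨ cong₂ _*_ (⟦⟧≡mkℚ m) (⟦⟧≡mkℚ n) ⟩
    (+ m ℤ.* + n) ℚ./ 1    ≡⟨ cong (ℚ._/ 1) (ℤ.pos-* m n) ⟨
    ⟦ m ℕ.* n ⟧            ∎
    where open ≡-Reasoning

  ⟦⟧-homo-∸ : ∀ {m n} → n ℕ.≤ m → ⟦ m ⟧ - ⟦ n ⟧ ≡ ⟦ m ℕ.∸ n ⟧
  ⟦⟧-homo-∸ {m} {n} n≤m = begin
    ⟦ m ⟧ - ⟦ n ⟧                      ≡⟨ cong (λ x → ⟦ x ⟧ - ⟦ n ⟧) (ℕₚ.m∸n+n≡m n≤m) ⟨
    ⟦ m ℕ.∸ n ℕ.+ n ⟧ - ⟦ n ⟧          ≡⟨ cong (_- ⟦ n ⟧) (⟦⟧-homo-+ (m ℕ.∸ n) n) ⟨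
    (⟦ m ℕ.∸ n ⟧ + ⟦ n ⟧) - ⟦ n ⟧      ≡⟨ solve 2 (λ x y → (x :+ y) :- y := x) refl ⟦ m ℕ.∸ n ⟧ ⟦ n ⟧ ⟩
    ⟦ m ℕ.∸ n ⟧                        ∎
    where open ≡-Reasoning

  0≤⟦⟧ : ∀ n → 0ℚ ≤ ⟦ n ⟧
  0≤⟦⟧ n = ⟦⟧-mono-≤ (ℕ.z≤n {n})

  record InverseBound (γ : ℚ) (N : ℕ) : Set where
    field
      bound : ∀ {y z} → γ * ⟦ y ⟧ < ⟦ z ⟧ → y ℕ.< N ℕ.* z

  -- The denominator N of γ works: N γ is the numerator of γ, which is at least 1.
  ∃-inverseBound : ∀ {γ} → 0ℚ < γ → ∃ (InverseBound γ)
  ∃-inverseBound {γ@(mkℚ +[1+ a ] b _)} _ = ℕ.suc b , record { bound = bound }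
    where
    N = ℕ.suc b

    N*γ≥1 : 1ℚ ≤ ⟦ N ⟧ * γ
    N*γ≥1 = ℚₚ.toℚᵘ-cancel-≤ (ℚᵘ.≤-respʳ-≃ (ℚᵘ.≃-sym (ℚₚ.toℚᵘ-homo-* ⟦ N ⟧ γ)) N*γ≥1ᵘ)
      where
      N*γ≥1ᵘ : ℚ.toℚᵘ 1ℚ ℚᵘ.≤ ℚ.toℚᵘ ⟦ N ⟧ ℚᵘ.* ℚ.toℚᵘ γ
      N*γ≥1ᵘ rewrite ⟦⟧≡mkℚ N = ℚᵘ.*≤* (subst₂ ℤ._≤_ (sym (ℤ.*-identityˡ _)) (sym (ℤ.*-identityʳ _))
        (+≤+ (ℕₚ.≤-trans (ℕₚ.≤-reflexive (ℕₚ.+-identityʳ N)) (ℕₚ.m≤m*n N (ℕ.suc a)))))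

    bound : ∀ {y z} → γ * ⟦ y ⟧ < ⟦ z ⟧ → y ℕ.< N ℕ.* z
    bound {y} {z} γy<z = ⟦⟧-cancel-< (begin-strict
      ⟦ y ⟧                   ≡⟨ ℚₚ.*-identityˡ ⟦ y ⟧ ⟨
      1ℚ * ⟦ y ⟧              ≤⟨ ℚₚ.*-monoʳ-≤-nonNeg ⟦ y ⟧ {{nonNegative (0≤⟦⟧ y)}} N*γ≥1 ⟩
      ⟦ N ⟧ * γ * ⟦ y ⟧       ≡⟨ ℚₚ.*-assoc ⟦ N ⟧ γ ⟦ y ⟧ ⟩
      ⟦ N ⟧ * (γ * ⟦ y ⟧)     <⟨ ℚₚ.*-monoʳ-<-pos ⟦ N ⟧ {{positive (⟦⟧-mono-< {0} {N} (ℕ.s≤s ℕ.z≤n))}} γy<z ⟩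
      ⟦ N ⟧ * ⟦ z ⟧           ≡⟨ ⟦⟧-homo-* N z ⟩
      ⟦ N ℕ.* z ⟧             ∎)
      where open ℚₚ.≤-Reasoning
  ∃-inverseBound {mkℚ (+ 0) _ _} (*<* (ℤ.+<+ ()))
  ∃-inverseBound {mkℚ ℤ.-[1+ _ ] _ _} (*<* ())

  laxity≡slack : ∀ k → r k ℕ.≤ d k → p k ℕ.≤ d k ℕ.∸ r k → laxity k ≡ ⟦ slack k ⟧
  laxity≡slack k r≤d p≤d∸r = trans (cong (_- ⟦ p k ⟧) (⟦⟧-homo-∸ r≤d)) (⟦⟧-homo-∸ p≤d∸r)

  βinterval-nonempty : ∀ β {x} k → InBetaInterval β k x → (β + β) * laxity k < ⟦ d k ⟧ - ⟦ r k ⟧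
  βinterval-nonempty β k (lo≤x , x<hi) =
    subst₂ _<_ shiftˡ shiftʳ (ℚₚ.+-monoˡ-< (β * ℓ - R) (ℚₚ.≤-<-trans lo≤x x<hi))
    where
    ℓ = laxity k
    R = ⟦ r k ⟧
    D = ⟦ d k ⟧
    shiftˡ : (R + β * ℓ) + (β * ℓ - R) ≡ (β + β) * ℓ
    shiftˡ = solve 3 (λ R B L → (R :+ B :* L) :+ (B :* L :- R) := (B :+ B) :* L) refl R β ℓ
    shiftʳ : (D - β * ℓ) + (β * ℓ - R) ≡ D - R
    shiftʳ = solve 4 (λ R D B L → (D :- B :* L) :+ (B :* L :- R) := D :- R) refl R D β ℓ

  -- If d < r then p = 0, so the laxity d − r is negative and, as β ≤ ½, the β-interval
  -- [r + βℓ, d − βℓ) is empty.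
  released≤deadline : ∀ β {x} k → β ≤ ½ → p k ℕ.≤ d k ℕ.∸ r k → InBetaInterval β k x → r k ℕ.≤ d k
  released≤deadline β k β≤½ p≤d∸r x∈I with r k ℕ.≤? d k
  ... | yes r≤d = r≤d
  ... | no r≰d = contradiction (ℚₚ.≤-<-trans δ≤2βℓ (βinterval-nonempty β k x∈I)) (ℚₚ.<-irrefl refl)
    where
    d≤r = ℕₚ.<⇒≤ (ℕₚ.≰⇒> r≰d)
    δ = ⟦ d k ⟧ - ⟦ r k ⟧
    ℓ≡δ : laxity k ≡ δ
    ℓ≡δ = begin
      δ - ⟦ p k ⟧ ≡⟨ cong (λ q → δ - ⟦ q ⟧) (ℕₚ.n≤0⇒n≡0 (subst (p k ℕ.≤_) (ℕₚ.m≤n⇒m∸n≡0 d≤r) p≤d∸r)) ⟩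
      δ - 0ℚ      ≡⟨ ℚₚ.+-identityʳ δ ⟩
      δ           ∎
      where open ≡-Reasoning
    δ≤0 : δ ≤ 0ℚ
    δ≤0 = subst (δ ≤_) (ℚₚ.+-inverseʳ ⟦ r k ⟧) (ℚₚ.+-monoˡ-≤ (- ⟦ r k ⟧) (⟦⟧-mono-≤ d≤r))
    δ≤2βℓ : δ ≤ (β + β) * laxity k
    δ≤2βℓ = begin
      δ               ≡⟨ ℚₚ.*-identityˡ δ ⟨
      1ℚ * δ          ≤⟨ ℚₚ.*-monoʳ-≤-nonPos δ {{ℚ.nonPositive δ≤0}} (ℚₚ.+-mono-≤ β≤½ β≤½) ⟩
      (β + β) * δ     ≡⟨ cong ((β + β) *_) ℓ≡δ ⟨
      (β + β) * laxity k ∎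
      where open ℚₚ.≤-Reasoning

  x≤x+y : ∀ x {y} → 0ℚ ≤ y → x ≤ x + y
  x≤x+y x 0≤y = subst (_≤ x + _) (ℚₚ.+-identityʳ x) (ℚₚ.+-monoʳ-≤ x 0≤y)

  x+y<z⇒y<z-x : ∀ {x y z} → x + y < z → y < z - x
  x+y<z⇒y<z-x {x} {y} {z} lt =
    subst₂ _<_ (solve 2 (λ x y → (x :+ y) :- x := y) refl x y) refl (ℚₚ.+-monoˡ-< (- x) lt)

  0≤β*laxity : ∀ {β} k → 0ℚ < β → laxity k ≡ ⟦ slack k ⟧ → 0ℚ ≤ β * laxity k
  0≤β*laxity {β} k 0<β ℓ≡ = subst (λ ℓ → 0ℚ ≤ β * ℓ) (sym ℓ≡) (ℚₚ.nonNegative⁻¹ (β * ⟦ slack k ⟧)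
    {{ℚₚ.nonNeg*nonNeg⇒nonNeg β {{nonNegative (ℚₚ.<⇒≤ 0<β)}} ⟦ slack k ⟧ {{nonNegative (0≤⟦⟧ (slack k))}}}})

  βinterval-bounds : ∀ β {x} k → InBetaInterval β k x →
                     ⟦ r k ⟧ + β * laxity k ≤ x × x + β * laxity k < ⟦ d k ⟧
  βinterval-bounds β {x} k (lo≤x , x<hi) = lo≤x ,
    subst (x + β * laxity k <_) (solve 2 (λ D B → (D :- B) :+ B := D) refl ⟦ d k ⟧ (β * laxity k))
      (ℚₚ.+-monoˡ-< (β * laxity k) x<hi)

  βinterval⇒r≤x<d : ∀ β {x} k → 0ℚ ≤ β * laxity k → InBetaInterval β k x → ⟦ r k ⟧ ≤ x × x < ⟦ d k ⟧
  βinterval⇒r≤x<d β {x} k 0≤βℓ x∈I =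
    ℚₚ.≤-trans (x≤x+y ⟦ r k ⟧ 0≤βℓ) (proj₁ bounds) , ℚₚ.≤-<-trans (x≤x+y x 0≤βℓ) (proj₂ bounds)
    where bounds = βinterval-bounds β {x} k x∈I

  β*laxity<d′-r′ : ∀ β {x} k k′ → (r k ℕ.< r k′ → d k ℕ.≤ d k′) → 0ℚ ≤ β * laxity k′ →
                    InBetaInterval β k x → InBetaInterval β k′ x → β * laxity k < ⟦ d k′ ⟧ - ⟦ r k′ ⟧
  β*laxity<d′-r′ β {x} k k′ r<r′⇒d≤d′ 0≤βℓ′ x∈I x∈I′ = x+y<z⇒y<z-x (reach (r k′ ℕ.≤? r k))
    where
    open ℚₚ.≤-Reasoning
    βℓ = β * laxity k
    reach : Dec (r k′ ℕ.≤ r k) → ⟦ r k′ ⟧ + βℓ < ⟦ d k′ ⟧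
    reach (yes r′≤r) = begin-strict
      ⟦ r k′ ⟧ + βℓ  ≤⟨ ℚₚ.+-monoˡ-≤ βℓ (⟦⟧-mono-≤ r′≤r) ⟩
      ⟦ r k ⟧ + βℓ   ≤⟨ proj₁ (βinterval-bounds β k x∈I) ⟩
      x              <⟨ proj₂ (βinterval⇒r≤x<d β k′ 0≤βℓ′ x∈I′) ⟩
      ⟦ d k′ ⟧       ∎
    reach (no r′≰r) = begin-strict
      ⟦ r k′ ⟧ + βℓ  ≤⟨ ℚₚ.+-monoˡ-≤ βℓ (proj₁ (βinterval⇒r≤x<d β k′ 0≤βℓ′ x∈I′)) ⟩
      x + βℓ         <⟨ proj₂ (βinterval-bounds β k x∈I) ⟩
      ⟦ d k ⟧        ≤⟨ ⟦⟧-mono-≤ (r<r′⇒d≤d′ (ℕₚ.≰⇒> r′≰r)) ⟩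
      ⟦ d k′ ⟧       ∎

  competes : ∀ {α β Nα Nβ} → 0ℚ < β → β ≤ ½ → InverseBound α Nα → InverseBound β Nβ →
             ∀ {k k′} → p k ℕ.≤ d k ℕ.∸ r k → p k′ ℕ.≤ d k′ ℕ.∸ r k′ →
             Tight α k′ → laxity k′ ≤ laxity k → BetaAgreeable β k k′ → Competes (Nβ ℕ.* Nα) k k′
  competes {α} {β} {Nα} {Nβ} 0<β β≤½ α⁻¹≤Nα β⁻¹≤Nβ {k} {k′} p≤d∸r p′≤d′∸r′ tight ℓ′≤ℓ
           ((r<r′⇒d≤d′ , _) , x , x∈I , x∈I′) = record
    { live   = agreeable⇒live {k} {k′} r<r′⇒d≤d′ (⟦⟧-cancel-< (ℚₚ.≤-<-trans (proj₁ x∈W) (proj₂ x∈W′)))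
                                                 (⟦⟧-cancel-< (ℚₚ.≤-<-trans (proj₁ x∈W′) (proj₂ x∈W)))
    ; slack≤ = ⟦⟧-cancel-≤ (subst₂ _≤_ ℓ′≡ ℓ≡ ℓ′≤ℓ)
    ; slack< = subst (slack k ℕ.<_) (sym (ℕₚ.*-assoc Nβ Nα (p k′)))
                 (ℕₚ.<-≤-trans L<Nβ*W′ (ℕₚ.*-monoʳ-≤ Nβ (ℕₚ.<⇒≤ W′<Nα*p′)))
    }
    where
    r′≤d′ = released≤deadline β k′ β≤½ p′≤d′∸r′ x∈I′
    ℓ≡ = laxity≡slack k (released≤deadline β k β≤½ p≤d∸r x∈I) p≤d∸r
    ℓ′≡ = laxity≡slack k′ r′≤d′ p′≤d′∸r′
    0≤βℓ′ = 0≤β*laxity k′ 0<β ℓ′≡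
    x∈W = βinterval⇒r≤x<d β k (0≤β*laxity k 0<β ℓ≡) x∈I
    x∈W′ = βinterval⇒r≤x<d β k′ 0≤βℓ′ x∈I′
    W′≡ : ⟦ d k′ ⟧ - ⟦ r k′ ⟧ ≡ ⟦ d k′ ℕ.∸ r k′ ⟧
    W′≡ = ⟦⟧-homo-∸ r′≤d′
    L<Nβ*W′ : slack k ℕ.< Nβ ℕ.* (d k′ ℕ.∸ r k′)
    L<Nβ*W′ = InverseBound.bound β⁻¹≤Nβ
      (subst₂ (λ ℓ w → β * ℓ < w) ℓ≡ W′≡ (β*laxity<d′-r′ β k k′ r<r′⇒d≤d′ 0≤βℓ′ x∈I x∈I′))
    W′<Nα*p′ : d k′ ℕ.∸ r k′ ℕ.< Nα ℕ.* p k′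
    W′<Nα*p′ = InverseBound.bound α⁻¹≤Nα (subst (λ w → α * w < ⟦ p k′ ⟧) W′≡ tight)

open FromRationals using (InverseBound; ∃-inverseBound; competes)

open import Data.Nat using (zero; suc; _+_; _*_; _∸_; _≤_; _<_; z≤n; s≤s; _≤?_)
open import Data.Nat.Properties
open import Data.Nat.Tactic.RingSolver using (solve-∀)
open import Data.Fin using (toℕ) renaming (zero to fzero; suc to fsuc)
import Data.Fin.Properties as Finₚ
open import Data.Fin.Subset using (inside; outside)
open import Data.Vec using ([]; _∷_; here; there)
open import Data.List using (filter; length; tabulate; applyUpTo; map)
import Data.Nat.ListAction as List
open import Data.Maybe using (Maybe; just)
open import Data.Maybe.Properties using (≡-dec; just-injective)
open import Algebra.Properties.Semiring.Sum +-*-semiring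
  using (sum; sum-syntax; ∑-comm; ∑-distrib-+; *-distribˡ-sum; sum-cong-≗)
open import Function using (_∘_; id)
open import Relation.Unary using (Pred; Decidable)

indicator : ∀ {ℓ} {P : Set ℓ} → Dec P → ℕ
indicator (yes _) = 1
indicator (no _)  = 0

∑-≤-* : ∀ k {b} {f : Fin k → ℕ} → (∀ i → f i ≤ b) → sum f ≤ k * b
∑-≤-* zero    f≤b = z≤n
∑-≤-* (suc k) f≤b = +-mono-≤ (f≤b fzero) (∑-≤-* k (f≤b ∘ fsuc))

∑-zero : ∀ k {f : Fin k → ℕ} → (∀ i → f i ≡ 0) → sum f ≡ 0
∑-zero zero    f≡0 = refl
∑-zero (suc k) f≡0 = cong₂ _+_ (f≡0 fzero) (∑-zero k (f≡0 ∘ fsuc))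

∑-split : ∀ k l (h : ℕ → ℕ) →
          ∑[ i < k + l ] h (toℕ i) ≡ ∑[ i < k ] h (toℕ i) + ∑[ i < l ] h (k + toℕ i)
∑-split zero    l h = refl
∑-split (suc k) l h = trans (cong (h 0 +_) (∑-split k l (h ∘ suc))) (sym (+-assoc (h 0) _ _))

∑-indicator-≡0 : ∀ {k ℓ} {P : Fin k → Set ℓ} (P? : ∀ i → Dec (P i)) → (∀ i → ¬ P i) →
                 ∑[ i < k ] indicator (P? i) ≡ 0
∑-indicator-≡0 {k} P? ¬P = ∑-zero k λ i → indicator-no (P? i) (¬P i)
  where
  indicator-no : ∀ {ℓ} {Q : Set ℓ} (Q? : Dec Q) → ¬ Q → indicator Q? ≡ 0
  indicator-no (yes q) ¬q = contradiction q ¬q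
  indicator-no (no _)  _  = refl

∑-indicator-≤1 : ∀ {k ℓ} {P : Fin k → Set ℓ} (P? : ∀ i → Dec (P i)) →
                 (∀ {i i′} → P i → P i′ → i ≡ i′) → ∑[ i < k ] indicator (P? i) ≤ 1
∑-indicator-≤1 {zero}  P? unique = z≤n
∑-indicator-≤1 {suc k} P? unique with P? fzero
... | yes P0 = ≤-reflexive (cong suc (∑-indicator-≡0 (P? ∘ fsuc) λ i P[1+i] → Finₚ.0≢1+n (unique P0 P[1+i])))
... | no _   = ∑-indicator-≤1 (P? ∘ fsuc) λ Pi Pi′ → Finₚ.suc-injective (unique Pi Pi′)

length-filter-tabulate : ∀ {a ℓ} {A : Set a} {P : Pred A ℓ} (P? : Decidable P) {k} (f : Fin k → A) →
                         length (filter P? (tabulate f)) ≡ ∑[ i < k ] indicator (P? (f i))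
length-filter-tabulate P? {zero}  f = refl
length-filter-tabulate P? {suc k} f with P? (f fzero)
... | yes _ = cong suc (length-filter-tabulate P? (f ∘ fsuc))
... | no _  = length-filter-tabulate P? (f ∘ fsuc)

sum-map-applyUpTo : ∀ (f g : ℕ → ℕ) T → List.sum (map f (applyUpTo g T)) ≡ ∑[ i < T ] f (g (toℕ i))
sum-map-applyUpTo f g zero    = refl
sum-map-applyUpTo f g (suc T) = cong (f (g 0) +_) (sum-map-applyUpTo f (g ∘ suc) T)

∣S∣*b≤∑ : ∀ {k b} (S : Subset k) (f : Fin k → ℕ) → (∀ i → i ∈ S → b ≤ f i) → ∣ S ∣ * b ≤ sum f
∣S∣*b≤∑ []            f b≤f = z≤n
∣S∣*b≤∑ (inside ∷ S)  f b≤f = +-mono-≤ (b≤f fzero here) (∣S∣*b≤∑ S (f ∘ fsuc) λ i i∈S → b≤f (fsuc i) (there i∈S))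
∣S∣*b≤∑ (outside ∷ S) f b≤f = ≤-trans (∣S∣*b≤∑ S (f ∘ fsuc) λ i i∈S → b≤f (fsuc i) (there i∈S)) (m≤n+m _ (f fzero))

windowSum : (ℕ → ℕ) → ℕ → ℕ → ℕ
windowSum f a K = ∑[ i < K ] f (a + toℕ i)

windowSum-split : ∀ f a K L → windowSum f a (K + L) ≡ windowSum f a K + windowSum f (a + K) L
windowSum-split f a K L = trans (∑-split K L (f ∘ (a +_)))
  (cong (windowSum f a K +_) (sum-cong-≗ {L} λ i → cong f (sym (+-assoc a K (toℕ i)))))

-- Half-open intervals [x, y) of slots, written as pairs (x , y).
_⊆ᵢ_ : ℕ × ℕ → ℕ × ℕ → Set
(x , y) ⊆ᵢ (a , b) = a ≤ x × y ≤ b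

windowStart : ℕ → ℕ → ℕ
windowStart c L = c ∸ 2 * L

windowWidth : ℕ → ℕ
windowWidth L = suc (4 * L)

centredWindow-overlap : ∀ {r′ d′ c} L → r′ ≤ c → c < d′ →
  let W = (windowStart c L , windowStart c L + windowWidth L) in
  (r′ , d′) ⊆ᵢ W ⊎ ∃ λ x → (x , x + suc (2 * L)) ⊆ᵢ W × (x , x + suc (2 * L)) ⊆ᵢ (r′ , d′)
centredWindow-overlap {r′} {d′} {c} L r′≤c c<d′ with windowStart c L ≤? r′
... | no a≰r′ =
  inj₂ (windowStart c L , (≤-refl , +-monoʳ-≤ (windowStart c L) (s≤s 2L≤4L)) , (<⇒≤ (≰⇒> a≰r′) , a+κ≤d′))
  where
  2L≤4L : 2 * L ≤ 4 * L
  2L≤4L = *-monoˡ-≤ L {2} {4} (s≤s (s≤s z≤n))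
  2L≤c : 2 * L ≤ c
  2L≤c = <⇒≤ (m∸n≢0⇒n<m {c} {2 * L} λ a≡0 → a≰r′ (subst (_≤ r′) (sym a≡0) z≤n))
  a+κ≤d′ : windowStart c L + suc (2 * L) ≤ d′
  a+κ≤d′ = subst (_≤ d′) (trans (cong suc (sym (m∸n+n≡m 2L≤c))) (sym (+-suc (windowStart c L) (2 * L))))
                  c<d′
... | yes a≤r′ with d′ ≤? windowStart c L + windowWidth L
...   | yes d′≤a+K = inj₁ (a≤r′ , d′≤a+K)
...   | no d′≰a+K =
  inj₂ (c , (m∸n≤m c (2 * L) , c+κ≤a+K) , (r′≤c , ≤-trans c+κ≤a+K (<⇒≤ (≰⇒> d′≰a+K))))
  where
  c+κ≤a+K : c + suc (2 * L) ≤ windowStart c L + windowWidth L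
  c+κ≤a+K = begin
    c + suc (2 * L)                          ≤⟨ +-monoˡ-≤ (suc (2 * L)) (m≤n+m∸n c (2 * L)) ⟩
    2 * L + windowStart c L + suc (2 * L)    ≡⟨ regroup L (windowStart c L) ⟩
    windowStart c L + suc (4 * L)            ∎
    where
    open ≤-Reasoning
    regroup : ∀ L a → 2 * L + a + suc (2 * L) ≡ a + suc (4 * L)
    regroup = solve-∀

record Processing (k : Job) : Set where
  field
    rate       : ℕ → ℕ
    rate≤1     : ∀ t → rate t ≤ 1
    rate-idle  : ∀ t → ¬ Live k t → rate t ≡ 0
    rate-total : windowSum rate 0 (d k) ≡ p k

module _ {k : Job} (π : Processing k) where
  open Processing π

  windowSum≤ : ∀ a K → windowSum rate a K ≤ K
  windowSum≤ a K = subst (windowSum rate a K ≤_) (*-identityʳ K) (∑-≤-* K λ i → rate≤1 (a + toℕ i))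

  windowSum-mono : ∀ {a K x κ} → (x , x + κ) ⊆ᵢ (a , a + K) → windowSum rate x κ ≤ windowSum rate a K
  windowSum-mono {a} {K} {x} {κ} (a≤x , x+κ≤a+K) with m≤n⇒∃[o]m+o≡n a≤x
  ... | u , refl with m≤n⇒∃[o]m+o≡n (+-cancelˡ-≤ a (u + κ) K (subst (_≤ a + K) (+-assoc a u κ) x+κ≤a+K))
  ... | v , refl = begin
    windowSum rate (a + u) κ                                          ≤⟨ m≤m+n _ _ ⟩
    windowSum rate (a + u) κ + windowSum rate (a + u + κ) v           ≡⟨ windowSum-split rate (a + u) κ v ⟨
    windowSum rate (a + u) (κ + v)                                    ≤⟨ m≤n+m _ _ ⟩
    windowSum rate a u + windowSum rate (a + u) (κ + v)               ≡⟨ windowSum-split rate a u (κ + v) ⟨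
    windowSum rate a (u + (κ + v))                                    ≡⟨ cong (windowSum rate a) (+-assoc u κ v) ⟨
    windowSum rate a (u + κ + v)                                      ∎
    where open ≤-Reasoning

  windowSum-before-release : ∀ {T} → T ≤ r k → windowSum rate 0 T ≡ 0
  windowSum-before-release {T} T≤r =
    ∑-zero T λ i → rate-idle (toℕ i) λ (r≤i , _) → <⇒≱ (<-≤-trans (Finₚ.toℕ<n i) T≤r) r≤i

  windowSum-after-deadline : ∀ v → windowSum rate (d k) v ≡ 0
  windowSum-after-deadline v =
    ∑-zero v λ i → rate-idle (d k + toℕ i) λ (_ , d+i<d) → <⇒≱ d+i<d (m≤m+n (d k) (toℕ i))

  processed≤ : ∀ T → windowSum rate 0 T ≤ T ∸ r k
  processed≤ T with T ≤? r k
  ... | yes T≤r = subst (_≤ T ∸ r k) (sym (windowSum-before-release T≤r)) z≤n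
  ... | no T≰r with m≤n⇒∃[o]m+o≡n (<⇒≤ (≰⇒> T≰r))
  ... | u , refl = begin
    windowSum rate 0 (r k + u)                         ≡⟨ windowSum-split rate 0 (r k) u ⟩
    windowSum rate 0 (r k) + windowSum rate (r k) u    ≡⟨ cong (_+ windowSum rate (r k) u) (windowSum-before-release ≤-refl) ⟩
    windowSum rate (r k) u                             ≤⟨ windowSum≤ (r k) u ⟩
    u                                                  ≡⟨ m+n∸m≡n (r k) u ⟨
    r k + u ∸ r k                                      ∎
    where open ≤-Reasoning

  processed-after-deadline : ∀ {T} → d k ≤ T → windowSum rate 0 T ≡ p k
  processed-after-deadline d≤T with m≤n⇒∃[o]m+o≡n d≤T
  ... | v , refl = begin
    windowSum rate 0 (d k + v)                         ≡⟨ windowSum-split rate 0 (d k) v ⟩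
    windowSum rate 0 (d k) + windowSum rate (d k) v    ≡⟨ cong₂ _+_ rate-total (windowSum-after-deadline v) ⟩
    p k + 0                                            ≡⟨ +-identityʳ (p k) ⟩
    p k                                                ∎
    where open ≡-Reasoning

  p≤d∸r : p k ≤ d k ∸ r k
  p≤d∸r = subst (_≤ d k ∸ r k) rate-total (processed≤ (d k))

  idle≤slack : ∀ {x κ} → (x , x + κ) ⊆ᵢ (r k , d k) → κ ≤ windowSum rate x κ + slack k
  idle≤slack {x} {κ} (r≤x , x+κ≤d) with m≤n⇒∃[o]m+o≡n r≤x
  ... | u , refl = +-cancelʳ-≤ v κ (W + slack k) (+-cancelˡ-≤ u (κ + v) (W + slack k + v) (begin
    u + (κ + v)                  ≡⟨ m+n∸m≡n (r k) (u + (κ + v)) ⟨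
    r k + (u + (κ + v)) ∸ r k    ≡⟨ cong (_∸ r k) (trans (reassoc (r k) u κ v) e+v≡d) ⟩
    d k ∸ r k                    ≡⟨ m∸n+n≡m p≤d∸r ⟨
    slack k + p k                ≤⟨ +-monoʳ-≤ (slack k) p≤u+W+v ⟩
    slack k + (u + W + v)        ≡⟨ rearrange (slack k) u W v ⟩
    u + (W + slack k + v)        ∎))
    where
    open ≤-Reasoning
    e = r k + u + κ
    W = windowSum rate (r k + u) κ
    v = d k ∸ e
    e+v≡d : e + v ≡ d k
    e+v≡d = m+[n∸m]≡n x+κ≤d
    reassoc : ∀ a b c e → a + (b + (c + e)) ≡ a + b + c + e
    reassoc = solve-∀
    rearrange : ∀ s a b c → s + (a + b + c) ≡ a + (b + s + c)
    rearrange = solve-∀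
    p≤u+W+v : p k ≤ u + W + v
    p≤u+W+v = begin
      p k                                            ≡⟨ processed-after-deadline (≤-reflexive (sym e+v≡d)) ⟨
      windowSum rate 0 (e + v)                       ≡⟨ windowSum-split rate 0 e v ⟩
      windowSum rate 0 e + windowSum rate e v        ≡⟨ cong (_+ windowSum rate e v) (windowSum-split rate 0 (r k + u) κ) ⟩
      windowSum rate 0 (r k + u) + W + windowSum rate e v
                                                     ≤⟨ +-mono-≤ (+-monoˡ-≤ W (processed≤ (r k + u))) (windowSum≤ e v) ⟩
      r k + u ∸ r k + W + v                          ≡⟨ cong (λ y → y + W + v) (m+n∸m≡n (r k) u) ⟩
      u + W + v                                      ∎

  windowSum-centred : ∀ {c} L → Live k c → slack k ≤ L →
                      let W = windowSum rate (windowStart c L) (windowWidth L) in p k ≤ W ⊎ suc L ≤ W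
  windowSum-centred {c} L (r≤c , c<d) slack≤L with centredWindow-overlap L r≤c c<d
  ... | inj₁ (a≤r , d≤a+K) = inj₁ (≤-reflexive (begin
    p k                                            ≡⟨ processed-after-deadline d≤a+K ⟨
    windowSum rate 0 (a + K)                       ≡⟨ windowSum-split rate 0 a K ⟩
    windowSum rate 0 a + windowSum rate a K        ≡⟨ cong (_+ windowSum rate a K) (windowSum-before-release a≤r) ⟩
    windowSum rate a K                             ∎))
    where
    open ≡-Reasoning
    a = windowStart c L
    K = windowWidth L
  ... | inj₂ (x , x⊆W , x⊆k) =
    inj₂ (≤-trans (+-cancelʳ-≤ L (suc L) (windowSum rate x (suc (2 * L))) L+1+L≤W+L) (windowSum-mono x⊆W))
    where
    L+1+L≤W+L : suc L + L ≤ windowSum rate x (suc (2 * L)) + L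
    L+1+L≤W+L = begin
      suc L + L                                     ≡⟨ cong suc (L+L≡2L L) ⟩
      suc (2 * L)                                   ≤⟨ idle≤slack x⊆k ⟩
      windowSum rate x (suc (2 * L)) + slack k      ≤⟨ +-monoʳ-≤ (windowSum rate x (suc (2 * L))) slack≤L ⟩
      windowSum rate x (suc (2 * L)) + L            ∎
      where
      open ≤-Reasoning
      L+L≡2L : ∀ L → L + L ≡ 2 * L
      L+L≡2L = solve-∀

  slack<N*windowSum-centred : ∀ {c L N} → Live k c → slack k ≤ L → L < N * p k →
                              L < N * windowSum rate (windowStart c L) (windowWidth L)
  slack<N*windowSum-centred {c} {L} {suc N} live slack≤L L<N*p with windowSum-centred L live slack≤L
  ... | inj₁ p≤W = <-≤-trans L<N*p (*-monoʳ-≤ (suc N) p≤W)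
  ... | inj₂ L<W = <-≤-trans L<W (m≤n*m _ (suc N))

module _ {m n} {J : Instance n} {σ : Schedule m n} (F : FeasibleSchedule J σ) where
  open FeasibleSchedule F

  machinesOn≡∑ : ∀ j t → machinesOn σ j t ≡ ∑[ i < m ] indicator (≡-dec Finₚ._≟_ (σ t i) (just j))
  machinesOn≡∑ j t = length-filter-tabulate (λ i → ≡-dec Finₚ._≟_ (σ t i) (just j)) {m} id

  machinesOn≤1 : ∀ j t → machinesOn σ j t ≤ 1
  machinesOn≤1 j t = subst (_≤ 1) (sym (machinesOn≡∑ j t))
    (∑-indicator-≤1 (λ i → ≡-dec Finₚ._≟_ (σ t i) (just j)) λ {i} {i′} → noParallel t i i′ j)

  machinesOn-idle : ∀ j t → ¬ Live (J j) t → machinesOn σ j t ≡ 0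
  machinesOn-idle j t ¬live = trans (machinesOn≡∑ j t)
    (∑-indicator-≡0 (λ i → ≡-dec Finₚ._≟_ (σ t i) (just j)) λ i σti≡j → ¬live (inWindow t i j σti≡j))

  ∑-machinesOn≤ : ∀ t → ∑[ j < n ] machinesOn σ j t ≤ m
  ∑-machinesOn≤ t = begin
    ∑[ j < n ] machinesOn σ j t                 ≡⟨ sum-cong-≗ {n} (λ j → machinesOn≡∑ j t) ⟩
    ∑[ j < n ] ∑[ i < m ] [ σ t i ≡just j ]    ≡⟨ ∑-comm {n} {m} (λ j i → [ σ t i ≡just j ]) ⟩
    ∑[ i < m ] ∑[ j < n ] [ σ t i ≡just j ]    ≤⟨ ∑-≤-* m (λ i → ∑-indicator-≤1 (λ j → ≡-dec Finₚ._≟_ (σ t i) (just j))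
                                                      λ σti≡j σti≡j′ → just-injective (trans (sym σti≡j) σti≡j′)) ⟩
    m * 1                                       ≡⟨ *-identityʳ m ⟩
    m                                           ∎
    where
    open ≤-Reasoning
    [_≡just_] : Maybe (Fin n) → Fin n → ℕ
    [ x ≡just j ] = indicator (≡-dec Finₚ._≟_ x (just j))

  processing : (j : Fin n) → Processing (J j)
  processing j = record
    { rate       = machinesOn σ j
    ; rate≤1     = machinesOn≤1 j
    ; rate-idle  = machinesOn-idle j
    ; rate-total = trans (sym (sum-map-applyUpTo (machinesOn σ j) id (d (J j)))) (complete j)
    }

  ∑-windowSum≤ : ∀ a K → ∑[ j < n ] windowSum (machinesOn σ j) a K ≤ K * m
  ∑-windowSum≤ a K = begin
    ∑[ j < n ] ∑[ i < K ] machinesOn σ j (a + toℕ i)   ≡⟨ ∑-comm {n} {K} (λ j i → machinesOn σ j (a + toℕ i)) ⟩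
    ∑[ i < K ] ∑[ j < n ] machinesOn σ j (a + toℕ i)   ≤⟨ ∑-≤-* K (λ i → ∑-machinesOn≤ (a + toℕ i)) ⟩
    K * m                                               ∎
    where open ≤-Reasoning

competitors≤ : ∀ {m n N} {J : Instance n} {σ : Schedule m n} → FeasibleSchedule J σ →
               ∀ j (S : Subset n) → (∀ j′ → j′ ∈ S → Competes N (J j) (J j′)) → ∣ S ∣ ≤ 8 * N * m
competitors≤ {m} {n} {N} {J} {σ} F j S competing = *-cancelʳ-≤ ∣ S ∣ (8 * N * m) (suc L) (begin
  ∣ S ∣ * suc L                                 ≤⟨ ∣S∣*b≤∑ S (λ j′ → N * w j′) member-bound ⟩
  ∑[ j′ < n ] (N * w j′)                        ≡⟨ *-distribˡ-sum N w ⟨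
  N * ∑[ j′ < n ] w j′                          ≡⟨ cong (N *_) (∑-distrib-+ (window cᵣ) (window c_d)) ⟩
  N * (∑[ j′ < n ] window cᵣ j′ + ∑[ j′ < n ] window c_d j′)
                                                ≤⟨ *-monoʳ-≤ N (+-mono-≤ (∑-windowSum≤ F (windowStart cᵣ L) K)
                                                                         (∑-windowSum≤ F (windowStart c_d L) K)) ⟩
  N * (K * m + K * m)                           ≤⟨ *-monoʳ-≤ N (+-mono-≤ (*-monoˡ-≤ m K≤4[L+1]) (*-monoˡ-≤ m K≤4[L+1])) ⟩
  N * (4 * suc L * m + 4 * suc L * m)           ≡⟨ regroup N m L ⟩
  8 * N * m * suc L                             ∎)
  where
  open ≤-Reasoning
  L = slack (J j)
  K = windowWidth L
  window : ℕ → Fin n → ℕ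
  window c j′ = windowSum (machinesOn σ j′) (windowStart c L) K
  cᵣ = r (J j)
  c_d = ℕ.pred (d (J j))
  w : Fin n → ℕ
  w j′ = window cᵣ j′ + window c_d j′

  window-bound : ∀ j′ → j′ ∈ S → ∀ {c} → Live (J j′) c → suc L ≤ N * window c j′
  window-bound j′ j′∈S live =
    slack<N*windowSum-centred (processing F j′) {N = N} live
      (Competes.slack≤ competes′) (Competes.slack< competes′)
    where competes′ = competing j′ j′∈S

  member-bound : ∀ j′ → j′ ∈ S → suc L ≤ N * w j′
  member-bound j′ j′∈S with Competes.live (competing j′ j′∈S)
  ... | inj₁ live = ≤-trans (window-bound j′ j′∈S live) (*-monoʳ-≤ N (m≤m+n (window cᵣ j′) (window c_d j′)))
  ... | inj₂ live = ≤-trans (window-bound j′ j′∈S live) (*-monoʳ-≤ N (m≤n+m (window c_d j′) (window cᵣ j′)))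

  K≤4[L+1] : K ≤ 4 * suc L
  K≤4[L+1] = subst (K ≤_) (sym (4[L+1] L)) (m≤n+m K 3)
    where
    4[L+1] : ∀ L → 4 * suc L ≡ 3 + suc (4 * L)
    4[L+1] = solve-∀
  regroup : ∀ N m L → N * (4 * suc L * m + 4 * suc L * m) ≡ 8 * N * m * suc L
  regroup = solve-∀

lemma1 : (α β : ℚ) → 0ℚ ℚ.< α → α ℚ.< 1ℚ → 0ℚ ℚ.< β → β ℚ.≤ ½ →
  ∃ λ (c : ℕ) →
    ∀ (m n : ℕ) (J : Instance n) → Feasible m J → (j : Fin n) →
    ∀ (S : Subset n) →
    (∀ j' → j' ∈ S →
       Tight α (J j') × laxity (J j') ℚ.≤ laxity (J j) × BetaAgreeable β (J j) (J j')) →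
    ∣ S ∣ ℕ.≤ c ℕ.* m
lemma1 α β 0<α _ 0<β β≤½ with ∃-inverseBound 0<α | ∃-inverseBound 0<β
... | Nα , α⁻¹≤Nα | Nβ , β⁻¹≤Nβ = 8 * (Nβ * Nα) , λ m n J (σ , F) j S S-bounds →
  competitors≤ F j S λ j′ j′∈S →
    let tight , ℓ′≤ℓ , agreeable = S-bounds j′ j′∈S in
    competes 0<β β≤½ α⁻¹≤Nα β⁻¹≤Nβ (p≤d∸r (processing F j)) (p≤d∸r (processing F j′)) tight ℓ′≤ℓ agreeable
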